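{- Let $\mathfrak{D} = \langle \mathfrak{M}, \star\rangle$ be a class of dynamic models. The following axiom schemata are valid in $\mathfrak{D}$ for any $\varphi \in \mathcal{L}_0$ and $\xi \in \mathcal{L}_\leq(\star)$ iff $\star$ is $\mathfrak{M}$-Rec-compliant: $$ \begin{array}{lcl} {}[\star\varphi][<]\xi &\rightarrow& (\neg \varphi \rightarrow A(\varphi \rightarrow [\star\varphi] \xi))\\ {}\varphi &\rightarrow &([\star\varphi][\leq]\varphi) \end{array}$$
   Context: Fix a set $P$ of propositional letters; $\mathcal{L}_0$ is the classical propositional language over $P$. A (well-founded) preference model is $M=\langle W,\leq,v\rangle$ with $W$ a set of worlds, $\leq$ a reflexive, transitive relation on $W$ whose strict part $<$ is well-founded, and $v:P\to 2^W$ a valuation; $\mathit{Mod}(\mathcal{L}_\leq)$ is the class of all such models. A dynamic operator is a map $\star:\mathit{Mod}(\mathcal{L}_\leq)\times\mathcal{L}_0\to\mathit{Mod}(\mathcal{L}_\leq)$ with $\star(M,\varphi)=\langle W,\leq_{\star\varphi},v\rangle$ (same worlds and valuation). The language $\mathcal{L}_\leq(\star)$ is built from $P$ with $\neg,\wedge$, the universal modality $A$ (dual $E$), the modalities $[\leq]$, $[<]$, and formulas $[\star\varphi]\xi$ with $\varphi\in\mathcal{L}_0$. A dynamic model is $D=\langle M,\star\rangle$, with $D,w\vDash A\xi$ iff every world satisfies $\xi$, $D,w\vDash[\leq]\xi$ iff every $w'\leq w$ satisfies $\xi$, $D,w\vDash[<]\xi$ iff every $w'<w$ satisfies $\xi$,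 and $D,w\vDash[\star\varphi]\xi$ iff $\langle\star(M,\varphi),\star\rangle,w\vDash\xi$. For a class $\mathfrak{M}$ of preference models over which $\star$ is closed, $\mathfrak{D}=\langle\mathfrak{M},\star\rangle$ is the class of dynamic models $\langle M,\star\rangle$ with $M\in\mathfrak{M}$; a formula is valid in $\mathfrak{D}$ if it is true at every world of every such model. $[\![\varphi]\!]$ denotes the set of worlds of the model under consideration satisfying $\varphi$. $\star$ is $\mathfrak{M}$-Rec-compliant if for every $M=\langle W,\leq,v\rangle\in\mathfrak{M}$, every $\varphi\in\mathcal{L}_0$ and all $w,w'\in W$, with $D=\langle M,\star\rangle$: (Rec') if $w\in[\![\varphi]\!]$ and $w'\notin[\![\varphi]\!]$, then $w'\not\leq_{\star\varphi}w$ and for every information $\xi$ with $D,w\vDash[\star\varphi]\xi$ there is $w''\in[\![\varphi]\!]$ with $D,w''\vDash[\star\varphi]\xi$ and $w''\leq_{\star\varphi}w'$. -}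

module Defs where

open import Level using (0ℓ)
open import Data.Empty using (⊥)
open import Data.Product using (Σ; _×_)
open import Relation.Nullary using (¬_)
open import Induction.WellFounded using (WellFounded)

record WFPreorder (W : Set) : Set₁ where
  field
    _≤_   : W → W → Set
    ≤-refl  : ∀ {w} → w ≤ w
    ≤-trans : ∀ {u w z} → u ≤ w → w ≤ z → u ≤ z
  _<_ : W → W → Set
  u < w = (u ≤ w) × ¬ (w ≤ u)
  field
    <-wf : WellFounded _<_

record PrefModel (P : Set) : Set₁ where
  field
    W   : Set
    ord : WFPreorder W
    v   : P → W → Set
  open WFPreorder ord public

open PrefModel public

data L0 (P : Set) : Set where
  var  : P → L0 P
  ¬₀_  : L0 P → L0 P
  _∧₀_ : L0 P → L0 P → L0 P

data Form (P : Set) : Set where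
  var   : P → Form P
  ~_    : Form P → Form P
  _∧_   : Form P → Form P → Form P
  A     : Form P → Form P
  [≤]   : Form P → Form P
  [<]   : Form P → Form P
  [⋆_]_ : L0 P → Form P → Form P

_⇒_ : ∀ {P} → Form P → Form P → Form P
a ⇒ b = ~ (a ∧ (~ b))

E : ∀ {P} → Form P → Form P
E a = ~ (A (~ a))

emb : ∀ {P} → L0 P → Form P
emb (var p)   = var p
emb (¬₀ φ)    = ~ emb φ
emb (φ ∧₀ ψ) = emb φ ∧ emb ψ

DynOp : Set → Set₁
DynOp P = (M : PrefModel P) → L0 P → WFPreorder (W M)

update : ∀ {P} → DynOp P → PrefModel P → L0 P → PrefModel P
update star M φ = record { W = W M ; ord = star M φ ; v = v M }

leq⋆ : ∀ {P} → DynOp P → (M : PrefModel P) → L0 P → W M → W M → Set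
leq⋆ star M φ u w = WFPreorder._≤_ (star M φ) u w

sat0 : ∀ {P} (M : PrefModel P) → L0 P → W M → Set
sat0 M (var p)   w = v M p w
sat0 M (¬₀ φ)    w = ¬ sat0 M φ w
sat0 M (φ ∧₀ ψ) w = sat0 M φ w × sat0 M ψ w

sat : ∀ {P} → DynOp P → (M : PrefModel P) → Form P → W M → Set
sat star M (var p)    w = v M p w
sat star M (~ ξ)      w = ¬ sat star M ξ w
sat star M (ξ ∧ χ)    w = sat star M ξ w × sat star M χ w
sat star M (A ξ)      w = ∀ u → sat star M ξ u
sat star M ([≤] ξ)    w = ∀ u → _≤_ M u w → sat star M ξ u
sat star M ([<] ξ)    w = ∀ u → _<_ M u w → sat star M ξ u
sat star M ([⋆ φ ] ξ) w = sat star (update star M φ) ξ w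

Closed : ∀ {P} → (PrefModel P → Set₁) → DynOp P → Set₁
Closed 𝔐 star = ∀ M → 𝔐 M → ∀ φ → 𝔐 (update star M φ)

Valid : ∀ {P} → (PrefModel P → Set₁) → DynOp P → Form P → Set₁
Valid 𝔐 star ξ = ∀ M → 𝔐 M → ∀ w → sat star M ξ w

RecCompliant : ∀ {P} → (PrefModel P → Set₁) → DynOp P → Set₁
RecCompliant {P} 𝔐 star =
  ∀ M → 𝔐 M → ∀ (φ : L0 P) (w w' : W M) →
    sat0 M φ w → ¬ sat0 M φ w' →
      ¬ (leq⋆ star M φ w' w)
      × (∀ (ξ : Form P) → sat star M ([⋆ φ ] ξ) w →
           Σ (W M) λ w'' → sat0 M φ w'' × sat star M ([⋆ φ ] ξ) w''
                             × (leq⋆ star M φ w'' w'))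

Ax1 : ∀ {P} → L0 P → Form P → Form P
Ax1 φ ξ = ([⋆ φ ] ([<] ξ)) ⇒ ((~ emb φ) ⇒ A (emb φ ⇒ ([⋆ φ ] ξ)))

Ax2 : ∀ {P} → L0 P → Form P
Ax2 φ = emb φ ⇒ ([⋆ φ ] ([≤] (emb φ)))

-- The first conjunct of Rec' says that ⋆φ never ranks a ¬φ-world at or below a φ-world,
-- which is what Ax2 expresses. Given that, Ax1 follows from the second conjunct: if [⋆φ]ξ
-- failed at a φ-world u while [⋆φ][<]ξ holds at a ¬φ-world w, Rec' applied to ¬ξ yields a
-- φ-world w'' ≤⋆ w without ξ, and w'' is strictly below w by the first conjunct.
-- Conversely, if Rec' had no witness for ξ, then [⋆φ][<]¬(φ ∧ ξ) would hold at the
-- ¬φ-world w', and Ax1 would refute [⋆φ]ξ at every φ-world.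
module Submission where

open import Defs
open import Data.Product using (_×_; _,_; proj₁; proj₂; Σ)
open import Function.Bundles using (_⇔_; mk⇔; Equivalence)
open import Function.Properties.Equivalence using () renaming (trans to ⇔-trans)
open import Axiom.ExcludedMiddle using (ExcludedMiddle)
open import Axiom.DoubleNegationElimination using (DoubleNegationElimination; em⇒dne)
open import Level using (0ℓ)
open import Data.Empty using (⊥)
open import Relation.Nullary using (¬_)

open Equivalence using (to; from)

module Semantics {P : Set} (star : DynOp P) where

  sat-emb : (M : PrefModel P) (φ : L0 P) (w : W M) → sat star M (emb φ) w ⇔ sat0 M φ w
  sat-emb M (var p)  w = mk⇔ (λ h → h) (λ h → h)
  sat-emb M (¬₀ φ)   w = mk⇔ (λ h s → h (from (sat-emb M φ w) s)) (λ h e → h (to (sat-emb M φ w) e))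
  sat-emb M (φ ∧₀ ψ) w = mk⇔ (λ (a , b) → to (sat-emb M φ w) a , to (sat-emb M ψ w) b)
                             (λ (a , b) → from (sat-emb M φ w) a , from (sat-emb M ψ w) b)

  sat0-update : (M : PrefModel P) (ψ φ : L0 P) (w : W M) → sat0 (update star M ψ) φ w ⇔ sat0 M φ w
  sat0-update M ψ (var p)  w = mk⇔ (λ h → h) (λ h → h)
  sat0-update M ψ (¬₀ φ)   w = mk⇔ (λ h s → h (from (sat0-update M ψ φ w) s))
                                   (λ h e → h (to (sat0-update M ψ φ w) e))
  sat0-update M ψ (φ ∧₀ χ) w = mk⇔ (λ (a , b) → to (sat0-update M ψ φ w) a , to (sat0-update M ψ χ w) b)
                                   (λ (a , b) → from (sat0-update M ψ φ w) a , from (sat0-update M ψ χ w) b)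

  sat-⋆-emb : (M : PrefModel P) (ψ φ : L0 P) (w : W M) → sat star M ([⋆ ψ ] emb φ) w ⇔ sat0 M φ w
  sat-⋆-emb M ψ φ w = ⇔-trans (sat-emb (update star M ψ) φ w) (sat0-update M ψ φ w)

  ⇒-intro : (M : PrefModel P) (a b : Form P) (w : W M) →
            (sat star M a w → sat star M b w) → sat star M (a ⇒ b) w
  ⇒-intro M a b w f (x , ¬y) = ¬y (f x)

  ⇒-elim : DoubleNegationElimination 0ℓ → (M : PrefModel P) (a b : Form P) (w : W M) →
           sat star M (a ⇒ b) w → sat star M a w → sat star M b w
  ⇒-elim dne M a b w h x = dne (λ ¬y → h (x , ¬y))

  RecOrder : (M : PrefModel P) → L0 P → Set
  RecOrder M φ = ∀ w w' → sat0 M φ w → ¬ sat0 M φ w' → ¬ leq⋆ star M φ w' w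

  RecWitness : (M : PrefModel P) → L0 P → Set
  RecWitness M φ = ∀ w w' → sat0 M φ w → ¬ sat0 M φ w' → ∀ ξ → sat star M ([⋆ φ ] ξ) w →
    Σ (W M) λ w'' → sat0 M φ w'' × sat star M ([⋆ φ ] ξ) w'' × leq⋆ star M φ w'' w'

  ax2⇒recOrder : (M : PrefModel P) (φ : L0 P) → (∀ w → sat star M (Ax2 φ) w) → RecOrder M φ
  ax2⇒recOrder M φ ax2 w w' φw ¬φw' w'≤w =
    ax2 w (from (sat-emb M φ w) φw , λ below → ¬φw' (to (sat-⋆-emb M φ φ w') (below w' w'≤w)))

  recOrder⇒ax2 : DoubleNegationElimination 0ℓ → (M : PrefModel P) (φ : L0 P) →
                 RecOrder M φ → ∀ w → sat star M (Ax2 φ) w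
  recOrder⇒ax2 dne M φ order w = ⇒-intro M (emb φ) ([⋆ φ ] ([≤] (emb φ))) w λ φw u u≤w →
    from (sat-⋆-emb M φ φ u)
      (dne λ ¬φu → order w u (to (sat-emb M φ w) φw) ¬φu u≤w)

  ax1⇒recWitness : DoubleNegationElimination 0ℓ → (M : PrefModel P) (φ : L0 P) →
                   (∀ ξ w → sat star M (Ax1 φ ξ) w) → RecWitness M φ
  ax1⇒recWitness dne M φ ax1 w w' φw ¬φw' ξ ξw = dne no-witness⇒⊥
    where
    ξ' : Form P
    ξ' = ~ (emb φ ∧ ξ)

    no-witness⇒⊥ : ¬ (Σ (W M) λ w'' → sat0 M φ w'' × sat star M ([⋆ φ ] ξ) w'' × leq⋆ star M φ w'' w') → ⊥
    no-witness⇒⊥ none = ξ'-everywhere w (from (sat-emb M φ w) φw , λ ¬ξ'w → ¬ξ'w (from (sat-⋆-emb M φ φ w) φw , ξw))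
      where
      ξ'-below-w' : sat star M ([⋆ φ ] ([<] ξ')) w'
      ξ'-below-w' u (u≤w' , _) (φu , ξu) = none (u , to (sat-⋆-emb M φ φ u) φu , ξu , u≤w')

      ξ'-everywhere : sat star M (A (emb φ ⇒ ([⋆ φ ] ξ'))) w'
      ξ'-everywhere =
        ⇒-elim dne M (~ emb φ) (A (emb φ ⇒ ([⋆ φ ] ξ'))) w'
          (⇒-elim dne M ([⋆ φ ] ([<] ξ')) ((~ emb φ) ⇒ A (emb φ ⇒ ([⋆ φ ] ξ'))) w' (ax1 ξ' w') ξ'-below-w')
          (λ φw' → ¬φw' (to (sat-emb M φ w') φw'))

  rec⇒ax1 : DoubleNegationElimination 0ℓ → (M : PrefModel P) (φ : L0 P) →
            RecOrder M φ → RecWitness M φ → ∀ ξ w → sat star M (Ax1 φ ξ) w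
  rec⇒ax1 dne M φ order witness ξ w =
    ⇒-intro M ([⋆ φ ] ([<] ξ)) ((~ emb φ) ⇒ A (emb φ ⇒ ([⋆ φ ] ξ))) w λ ξ-below-w →
    ⇒-intro M (~ emb φ) (A (emb φ ⇒ ([⋆ φ ] ξ))) w λ ¬⟦φ⟧w u →
    ⇒-intro M (emb φ) ([⋆ φ ] ξ) u λ φu → dne λ ¬ξu →
      let ¬φw = λ φw → ¬⟦φ⟧w (from (sat-emb M φ w) φw)
          (w'' , φw'' , ¬ξw'' , w''≤w) = witness u w (to (sat-emb M φ u) φu) ¬φw (~ ξ) ¬ξu
      in ¬ξw'' (ξ-below-w w'' (w''≤w , order w'' w φw'' ¬φw))

open Semantics

proposition39 : (P : Set) (𝔐 : PrefModel P → Set₁) (star : DynOp P) →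
    ExcludedMiddle 0ℓ → Closed 𝔐 star →
    ((∀ φ ξ → Valid 𝔐 star (Ax1 φ ξ)) × (∀ φ → Valid 𝔐 star (Ax2 φ)))
      ⇔ RecCompliant 𝔐 star
proposition39 P 𝔐 star em _ = mk⇔ axioms⇒rec rec⇒axioms
  where
  dne : DoubleNegationElimination 0ℓ
  dne = em⇒dne em

  axioms⇒rec : (∀ φ ξ → Valid 𝔐 star (Ax1 φ ξ)) × (∀ φ → Valid 𝔐 star (Ax2 φ)) → RecCompliant 𝔐 star
  axioms⇒rec (ax1 , ax2) M M∈𝔐 φ w w' φw ¬φw' =
      ax2⇒recOrder star M φ (ax2 φ M M∈𝔐) w w' φw ¬φw'
    , ax1⇒recWitness star dne M φ (λ ξ → ax1 φ ξ M M∈𝔐) w w' φw ¬φw'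

  rec⇒axioms : RecCompliant 𝔐 star → (∀ φ ξ → Valid 𝔐 star (Ax1 φ ξ)) × (∀ φ → Valid 𝔐 star (Ax2 φ))
  rec⇒axioms rec =
      (λ φ ξ M M∈𝔐 → rec⇒ax1 star dne M φ (order M M∈𝔐 φ) (witness M M∈𝔐 φ) ξ)
    , (λ φ M M∈𝔐 → recOrder⇒ax2 star dne M φ (order M M∈𝔐 φ))
    where
    order : ∀ M → 𝔐 M → ∀ φ → RecOrder star M φ
    order M M∈𝔐 φ w w' φw ¬φw' = proj₁ (rec M M∈𝔐 φ w w' φw ¬φw')

    witness : ∀ M → 𝔐 M → ∀ φ → RecWitness star M φ
    witness M M∈𝔐 φ w w' φw ¬φw' = proj₂ (rec M M∈𝔐 φ w w' φw ¬φw')
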